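{- If a graph $G$ contains a universal vertex, then $\mathrm{sg_e}(G) \ge n(G)-1$. Moreover, if $G$ has exactly one universal vertex, then $\mathrm{sg_e}(G) = n(G)-1$.
   Context: All graphs are finite and simple; $n(G)=|V(G)|$. A vertex $u$ is universal if $\deg_G(u)=n(G)-1$. For a graph $G$, a set $S\subseteq V(G)$ is a strong edge geodetic set if to each (unordered) pair of vertices $x,y\in S$ one can assign one shortest $x,y$-path (or no path) such that every edge of $G$ lies on at least one of the assigned paths; $\mathrm{sg_e}(G)$ is the minimum cardinality of such a set. -}

module Defs where

open import Data.Nat using (ℕ; zero; suc; _≤_; _∸_)
open import Data.Fin using (Fin; _<_)
open import Data.Fin.Subset using (Subset; _∈_; ∣_∣)
open import Data.Vec using (tabulate)
open import Data.Maybe using (Maybe; just)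
open import Data.Product using (Σ; ∃; _×_; _,_; proj₁)
open import Data.Sum using (_⊎_)
open import Relation.Nullary using (¬_; does)
open import Relation.Binary using (Decidable)
open import Relation.Binary.PropositionalEquality using (_≡_)

record Graph (n : ℕ) : Set₁ where
  field
    Adj    : Fin n → Fin n → Set
    adj?   : Decidable Adj
    sym    : ∀ {x y} → Adj x y → Adj y x
    irrefl : ∀ {x} → ¬ Adj x x

module _ {n : ℕ} (G : Graph n) where
  open Graph G

  N : Fin n → Subset n
  N u = tabulate (λ v → does (adj? u v))

  deg : Fin n → ℕ
  deg u = ∣ N u ∣

  Universal : Fin n → Set
  Universal u = deg u ≡ n ∸ 1

  data Walk : Fin n → Fin n → Set where
    []   : ∀ {x} → Walk x x
    _∷_  : ∀ {x y z} → Adj x y → Walk y z → Walk x z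

  len : ∀ {x y} → Walk x y → ℕ
  len []      = 0
  len (_ ∷ w) = suc (len w)

  IsShortest : ∀ {x y} → Walk x y → Set
  IsShortest {x} {y} w = (w' : Walk x y) → len w ≤ len w'

  Geodesic : Fin n → Fin n → Set
  Geodesic x y = Σ (Walk x y) IsShortest

  data EdgeOn (u v : Fin n) : ∀ {x y} → Walk x y → Set where
    here-uv : ∀ {z} (e : Adj u v) (w : Walk v z) → EdgeOn u v (e ∷ w)
    here-vu : ∀ {z} (e : Adj v u) (w : Walk u z) → EdgeOn u v (e ∷ w)
    there   : ∀ {x y z} (e : Adj x y) {w : Walk y z} → EdgeOn u v w → EdgeOn u v (e ∷ w)

  -- an assignment of one shortest path (or none) to each unordered pair
  -- {x, y} of distinct vertices of S (represented by x < y)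
  Assignment : Subset n → Set
  Assignment S = (x y : Fin n) → x < y → x ∈ S → y ∈ S → Maybe (Geodesic x y)

  StrongEdgeGeodetic : Subset n → Set
  StrongEdgeGeodetic S =
    Σ (Assignment S) λ P →
      ∀ u v → Adj u v →
        ∃ λ x → ∃ λ y → Σ (x < y) λ x<y → Σ (x ∈ S) λ x∈S → Σ (y ∈ S) λ y∈S →
          Σ (Geodesic x y) λ g →
            (P x y x<y x∈S y∈S ≡ just g) × EdgeOn u v (proj₁ g)

  sgₑ≥ : ℕ → Set
  sgₑ≥ k = (S : Subset n) → StrongEdgeGeodetic S → k ≤ ∣ S ∣

  sgₑ≡ : ℕ → Set
  sgₑ≡ k = sgₑ≥ k × ∃ λ S → StrongEdgeGeodetic S × ∣ S ∣ ≡ k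

  UniqueUniversal : Set
  UniqueUniversal = ∃ λ u → Universal u × (∀ v → Universal v → v ≡ u)

-- Through a universal vertex u every two vertices are at distance at most 2, so a
-- geodesic containing an edge uv cannot continue past v: v is one of its ends.
-- Hence every vertex other than u lies in each strong edge geodetic set.  If u is the
-- only universal vertex, V − u is one: the pair x, y gets the edge xy or the path xuy,
-- and an edge uv is covered by the path vuw to a non-neighbour w of v, which exists
-- because v is not universal and differs from u because u is.

module Submission where

open import Defs
open import Data.Nat using (ℕ; _∸_)
open import Data.Product using (∃; _×_)

import Data.Nat as ℕ
open import Data.Nat using (suc; _+_; _≤_; z≤n; s≤s)
open import Data.Nat.Properties using (≤-antisym; ≤-trans; <-irrefl; +-cancelˡ-≤; +-cancelʳ-≤)
open import Data.Fin using (Fin; _<_)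
open import Data.Fin.Properties using (_≟_; <-cmp; <⇒≢; ¬∀⟶∃¬)
open import Data.Fin.Subset using (Subset; _∈_; ∣_∣; ⁅_⁆; ∁; _⊆_)
open import Data.Fin.Subset.Properties
  using (p⊆q⇒∣p∣≤∣q∣; p⊂q⇒∣p∣<∣q∣; ∣∁p∣≡n∸∣p∣; ∣⁅x⁆∣≡1; x∈∁p⇒x∉p; x∉p⇒x∈∁p; x∉⁅y⁆⇒x≢y; x≢y⇒x∉⁅y⁆)
open import Data.Vec.Properties using (lookup∘tabulate; []=⇒lookup; lookup⇒[]=)
open import Data.Maybe using (just)
open import Data.Product using (Σ; _,_; proj₁; proj₂)
open import Data.Sum using (_⊎_; inj₁; inj₂)
open import Data.Empty using (⊥-elim)
open import Function using (_∘_)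
open import Relation.Nullary using (¬_; Dec; yes; no)
open import Relation.Nullary.Decidable using (dec-true; _⊎-dec_)
open import Relation.Binary using (tri<; tri≈; tri>)
open import Relation.Binary.PropositionalEquality using (_≡_; _≢_; refl; sym; trans; subst; subst₂; cong)

∈∁⁅x⁆⇒≢ : ∀ {n} {x y : Fin n} → y ∈ ∁ ⁅ x ⁆ → y ≢ x
∈∁⁅x⁆⇒≢ = x∉⁅y⁆⇒x≢y ∘ x∈∁p⇒x∉p

≢⇒∈∁⁅x⁆ : ∀ {n} {x y : Fin n} → y ≢ x → y ∈ ∁ ⁅ x ⁆
≢⇒∈∁⁅x⁆ = x∉p⇒x∈∁p ∘ x≢y⇒x∉⁅y⁆

∣∁⁅x⁆∣≡n∸1 : ∀ {n} (x : Fin n) → ∣ ∁ ⁅ x ⁆ ∣ ≡ n ∸ 1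
∣∁⁅x⁆∣≡n∸1 {n} x = trans (∣∁p∣≡n∸∣p∣ ⁅ x ⁆) (cong (n ∸_) (∣⁅x⁆∣≡1 x))

∁⁅x⁆⊆p⇒n∸1≤∣p∣ : ∀ {n} {x : Fin n} {p : Subset n} → ∁ ⁅ x ⁆ ⊆ p → n ∸ 1 ≤ ∣ p ∣
∁⁅x⁆⊆p⇒n∸1≤∣p∣ {x = x} ⊆p = subst (_≤ _) (∣∁⁅x⁆∣≡n∸1 x) (p⊆q⇒∣p∣≤∣q∣ ⊆p)

module _ {n : ℕ} (G : Graph n) where
  open Graph G renaming (sym to Adj-sym)

  Adj⇒∈N : ∀ {u v} → Adj u v → v ∈ N G u
  Adj⇒∈N {u} {v} e = lookup⇒[]= v _ (trans (lookup∘tabulate _ v) (dec-true (adj? u v) e))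

  ∈N⇒Adj : ∀ {u v} → v ∈ N G u → Adj u v
  ∈N⇒Adj {u} {v} v∈ with adj? u v | trans (sym (lookup∘tabulate _ v)) ([]=⇒lookup v∈)
  ... | yes e | _  = e
  ... | no _  | ()

  N⊆∁⁅x⁆ : ∀ u → N G u ⊆ ∁ ⁅ u ⁆
  N⊆∁⁅x⁆ u v∈ = ≢⇒∈∁⁅x⁆ λ { refl → irrefl (∈N⇒Adj v∈) }

  universal⇒adjacent : ∀ {u} → Universal G u → ∀ {v} → v ≢ u → Adj u v
  universal⇒adjacent {u} univ {v} v≢u with adj? u v
  ... | yes e = e
  ... | no ¬e = ⊥-elim (<-irrefl univ deg<n∸1)
    where
    deg<n∸1 : deg G u ℕ.< n ∸ 1
    deg<n∸1 = subst (deg G u ℕ.<_) (∣∁⁅x⁆∣≡n∸1 u)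
      (p⊂q⇒∣p∣<∣q∣ (N⊆∁⁅x⁆ u , v , ≢⇒∈∁⁅x⁆ v≢u , ¬e ∘ ∈N⇒Adj))

  adjacent⇒universal : ∀ {u} → (∀ {v} → v ≢ u → Adj u v) → Universal G u
  adjacent⇒universal {u} adj = ≤-antisym
    (subst (deg G u ≤_) (∣∁⁅x⁆∣≡n∸1 u) (p⊆q⇒∣p∣≤∣q∣ (N⊆∁⁅x⁆ u)))
    (∁⁅x⁆⊆p⇒n∸1≤∣p∣ (Adj⇒∈N ∘ adj ∘ ∈∁⁅x⁆⇒≢))

  ¬universal⇒non-neighbour : ∀ {u} → ¬ Universal G u → ∃ λ w → w ≢ u × ¬ Adj u w
  ¬universal⇒non-neighbour {u} ¬univ
    with ¬∀⟶∃¬ n (λ w → w ≡ u ⊎ Adj u w) (λ w → (w ≟ u) ⊎-dec (adj? u w))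
           (λ all → ¬univ (adjacent⇒universal (λ {v} v≢u → neighbour v≢u (all v))))
    where
    neighbour : ∀ {v} → v ≢ u → v ≡ u ⊎ Adj u v → Adj u v
    neighbour v≢u (inj₁ v≡u) = ⊥-elim (v≢u v≡u)
    neighbour v≢u (inj₂ e)   = e
  ... | w , ¬w = w , ¬w ∘ inj₁ , ¬w ∘ inj₂

  _++_ : ∀ {x y z} → Walk G x y → Walk G y z → Walk G x z
  []      ++ b = b
  (e ∷ a) ++ b = e ∷ (a ++ b)

  len-++ : ∀ {x y z} (a : Walk G x y) (b : Walk G y z) → len G (a ++ b) ≡ len G a + len G b
  len-++ []      b = refl
  len-++ (e ∷ a) b = cong suc (len-++ a b)

  IsShortest-++ʳ : ∀ {x y z} (a : Walk G x y) (b : Walk G y z) → IsShortest G (a ++ b) → IsShortest G b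
  IsShortest-++ʳ a b sh b′ = +-cancelˡ-≤ (len G a) _ _
    (subst₂ _≤_ (len-++ a b) (len-++ a b′) (sh (a ++ b′)))

  IsShortest-++ˡ : ∀ {x y z} (a : Walk G x y) (b : Walk G y z) → IsShortest G (a ++ b) → IsShortest G a
  IsShortest-++ˡ a b sh a′ = +-cancelʳ-≤ (len G b) _ _
    (subst₂ _≤_ (len-++ a b) (len-++ a′ b) (sh (a′ ++ b)))

  EdgeOn-sym : ∀ {u v x y} {w : Walk G x y} → EdgeOn G u v w → EdgeOn G v u w
  EdgeOn-sym (here-uv e w) = here-vu e w
  EdgeOn-sym (here-vu e w) = here-uv e w
  EdgeOn-sym (there e p)   = there e (EdgeOn-sym p)

  split-EdgeOn : ∀ {u v x y} {w : Walk G x y} → EdgeOn G u v w →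
    Σ (Walk G x u) λ a → Σ (Walk G u y) λ b → w ≡ a ++ b ×
      ((Σ (Adj u v) λ e → Σ (Walk G v y) λ b′ → b ≡ e ∷ b′)
       ⊎ (Σ (Walk G x v) λ a′ → Σ (Adj v u) λ e → a ≡ a′ ++ (e ∷ [])))
  split-EdgeOn (here-uv e w) = [] , e ∷ w , refl , inj₁ (e , w , refl)
  split-EdgeOn (here-vu e w) = e ∷ [] , w , refl , inj₂ ([] , e , refl)
  split-EdgeOn (there e p) with split-EdgeOn p
  ... | a , b , refl , inj₁ after           = e ∷ a , b , refl , inj₁ after
  ... | a , b , refl , inj₂ (a′ , f , refl) = e ∷ a , b , refl , inj₂ (e ∷ a′ , f , refl)

  CoveredBy : ∀ {S} → Assignment G S → Fin n → Fin n → Set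
  CoveredBy {S} P u v =
    ∃ λ x → ∃ λ y → Σ (x < y) λ x<y → Σ (x ∈ S) λ x∈S → Σ (y ∈ S) λ y∈S →
      Σ (Geodesic G x y) λ g → (P x y x<y x∈S y∈S ≡ just g) × EdgeOn G u v (proj₁ g)

  CoveredBy-sym : ∀ {S} {P : Assignment G S} {u v} → CoveredBy P u v → CoveredBy P v u
  CoveredBy-sym (x , y , x<y , x∈S , y∈S , g , P≡g , p) = x , y , x<y , x∈S , y∈S , g , P≡g , EdgeOn-sym p

  1≤len : ∀ {x y} → x ≢ y → (w : Walk G x y) → 1 ≤ len G w
  1≤len x≢y []      = ⊥-elim (x≢y refl)
  1≤len x≢y (_ ∷ _) = s≤s z≤n

  2≤len : ∀ {x y} → x ≢ y → ¬ Adj x y → (w : Walk G x y) → 2 ≤ len G w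
  2≤len x≢y ¬e []            = ⊥-elim (x≢y refl)
  2≤len x≢y ¬e (e ∷ [])      = ⊥-elim (¬e e)
  2≤len x≢y ¬e (_ ∷ (_ ∷ _)) = s≤s (s≤s z≤n)

  module _ {u} (u-universal : Universal G u) where

    walk-to-universal : ∀ x → Σ (Walk G x u) λ w → len G w ≤ 1
    walk-to-universal x with x ≟ u
    ... | yes refl = [] , z≤n
    ... | no x≢u   = Adj-sym (universal⇒adjacent u-universal x≢u) ∷ [] , s≤s z≤n

    walk-from-universal : ∀ y → Σ (Walk G u y) λ w → len G w ≤ 1
    walk-from-universal y with y ≟ u
    ... | yes refl = [] , z≤n
    ... | no y≢u   = universal⇒adjacent u-universal y≢u ∷ [] , s≤s z≤n

    IsShortest-from-universal : ∀ {y} (w : Walk G u y) → IsShortest G w → len G w ≤ 1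
    IsShortest-from-universal {y} w sh = ≤-trans (sh _) (proj₂ (walk-from-universal y))

    IsShortest-to-universal : ∀ {x} (w : Walk G x u) → IsShortest G w → len G w ≤ 1
    IsShortest-to-universal {x} w sh = ≤-trans (sh _) (proj₂ (walk-to-universal x))

    -- The part of a geodesic on the side of v is a geodesic to or from u, so it is the edge uv alone.
    EdgeOn-universal⇒endpoint : ∀ {v x y} {w : Walk G x y} → IsShortest G w →
      EdgeOn G u v w → v ≡ x ⊎ v ≡ y
    EdgeOn-universal⇒endpoint sh p with split-EdgeOn p
    ... | a , _ , refl , inj₁ (e , b′ , refl) =
      inj₂ (last e b′ (IsShortest-from-universal (e ∷ b′) (IsShortest-++ʳ a (e ∷ b′) sh)))
      where
      last : ∀ {v y} (e : Adj u v) (b′ : Walk G v y) → len G (e ∷ b′) ≤ 1 → v ≡ y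
      last _ []      _        = refl
      last _ (_ ∷ _) (s≤s ())
    ... | _ , b , refl , inj₂ (a′ , e , refl) =
      inj₁ (sym (first a′ e
        (IsShortest-to-universal (a′ ++ (e ∷ [])) (IsShortest-++ˡ (a′ ++ (e ∷ [])) b sh))))
      where
      first : ∀ {x v} (a′ : Walk G x v) (e : Adj v u) → len G (a′ ++ (e ∷ [])) ≤ 1 → x ≡ v
      first []            _ _        = refl
      first (_ ∷ [])      _ (s≤s ())
      first (_ ∷ (_ ∷ _)) _ (s≤s ())

    universal⇒sgₑ≥n∸1 : sgₑ≥ G (n ∸ 1)
    universal⇒sgₑ≥n∸1 S (_ , covered) = ∁⁅x⁆⊆p⇒n∸1≤∣p∣ v∈S
      where
      v∈S : ∀ {v} → v ∈ ∁ ⁅ u ⁆ → v ∈ S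
      v∈S v∈ with covered u _ (universal⇒adjacent u-universal (∈∁⁅x⁆⇒≢ v∈))
      ... | _ , _ , _ , x∈S , y∈S , (_ , sh) , _ , p with EdgeOn-universal⇒endpoint sh p
      ... | inj₁ refl = x∈S
      ... | inj₂ refl = y∈S

    hub : ∀ {x} → x ∈ ∁ ⁅ u ⁆ → Adj u x
    hub = universal⇒adjacent u-universal ∘ ∈∁⁅x⁆⇒≢

    route : ∀ {x y} → x ∈ ∁ ⁅ u ⁆ → y ∈ ∁ ⁅ u ⁆ → Dec (Adj x y) → Walk G x y
    route _  _  (yes e) = e ∷ []
    route x∈ y∈ (no _)  = Adj-sym (hub x∈) ∷ (hub y∈ ∷ [])

    module _ {x y} (x∈ : x ∈ ∁ ⁅ u ⁆) (y∈ : y ∈ ∁ ⁅ u ⁆) where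

      route-shortest : x ≢ y → (d : Dec (Adj x y)) → IsShortest G (route x∈ y∈ d)
      route-shortest x≢y (yes _) = 1≤len x≢y
      route-shortest x≢y (no ¬e) = 2≤len x≢y ¬e

      EdgeOn-route-adjacent : Adj x y → (d : Dec (Adj x y)) → EdgeOn G x y (route x∈ y∈ d)
      EdgeOn-route-adjacent _ (yes e) = here-uv e []
      EdgeOn-route-adjacent e (no ¬e) = ⊥-elim (¬e e)

      EdgeOn-route-hub : ¬ Adj x y → (d : Dec (Adj x y)) →
        EdgeOn G u x (route x∈ y∈ d) × EdgeOn G u y (route x∈ y∈ d)
      EdgeOn-route-hub ¬e (yes e) = ⊥-elim (¬e e)
      EdgeOn-route-hub _  (no _)  = here-vu _ _ , there _ (here-uv _ [])

    assignment : Assignment G (∁ ⁅ u ⁆)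
    assignment x y x<y x∈ y∈ = just (route x∈ y∈ (adj? x y) , route-shortest x∈ y∈ (<⇒≢ x<y) (adj? x y))

    CoveredBy-pair : ∀ {p q x y} → x ≢ y → (x∈ : x ∈ ∁ ⁅ u ⁆) (y∈ : y ∈ ∁ ⁅ u ⁆) →
      EdgeOn G p q (route x∈ y∈ (adj? x y)) → EdgeOn G p q (route y∈ x∈ (adj? y x)) →
      CoveredBy assignment p q
    CoveredBy-pair {x = x} {y} x≢y x∈ y∈ on-xy on-yx with <-cmp x y
    ... | tri< x<y _ _ = x , y , x<y , x∈ , y∈ , _ , refl , on-xy
    ... | tri≈ _ x≡y _ = ⊥-elim (x≢y x≡y)
    ... | tri> _ _ y<x = y , x , y<x , y∈ , x∈ , _ , refl , on-yx

    module _ (u-unique : ∀ v → Universal G v → v ≡ u) where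

      -- b is not universal, and the route from b to a non-neighbour w of b passes through u.
      CoveredBy-hub-edge : ∀ {b} → b ∈ ∁ ⁅ u ⁆ → CoveredBy assignment u b
      CoveredBy-hub-edge {b} b∈ with ¬universal⇒non-neighbour (∈∁⁅x⁆⇒≢ b∈ ∘ u-unique b)
      ... | w , w≢b , ¬bw = CoveredBy-pair (w≢b ∘ sym) b∈ w∈
          (proj₁ (EdgeOn-route-hub b∈ w∈ ¬bw _)) (proj₂ (EdgeOn-route-hub w∈ b∈ (¬bw ∘ Adj-sym) _))
        where
        w∈ : w ∈ ∁ ⁅ u ⁆
        w∈ = ≢⇒∈∁⁅x⁆ λ { refl → ¬bw (Adj-sym (hub b∈)) }

      CoveredBy-edge : ∀ p q → Adj p q → CoveredBy assignment p q
      CoveredBy-edge p q e with p ≟ u | q ≟ u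
      ... | yes refl | _        = CoveredBy-hub-edge (≢⇒∈∁⁅x⁆ λ { refl → irrefl e })
      ... | no p≢u   | yes refl = CoveredBy-sym (CoveredBy-hub-edge (≢⇒∈∁⁅x⁆ p≢u))
      ... | no p≢u   | no q≢u   = CoveredBy-pair (λ { refl → irrefl e }) p∈ q∈
          (EdgeOn-route-adjacent p∈ q∈ e _) (EdgeOn-sym (EdgeOn-route-adjacent q∈ p∈ (Adj-sym e) _))
        where
        p∈ : p ∈ ∁ ⁅ u ⁆
        p∈ = ≢⇒∈∁⁅x⁆ p≢u
        q∈ : q ∈ ∁ ⁅ u ⁆
        q∈ = ≢⇒∈∁⁅x⁆ q≢u

      unique-universal⇒strongEdgeGeodetic : StrongEdgeGeodetic G (∁ ⁅ u ⁆)
      unique-universal⇒strongEdgeGeodetic = assignment , CoveredBy-edge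

corollary3p4 : ∀ {n : ℕ} (G : Graph n) →
    ((∃ λ u → Universal G u) → sgₑ≥ G (n ∸ 1))
    × (UniqueUniversal G → sgₑ≡ G (n ∸ 1))
corollary3p4 G =
    (λ { (_ , u-universal) → universal⇒sgₑ≥n∸1 G u-universal })
  , (λ { (u , u-universal , u-unique) →
           universal⇒sgₑ≥n∸1 G u-universal
         , ∁ ⁅ u ⁆ , unique-universal⇒strongEdgeGeodetic G u-universal u-unique , ∣∁⁅x⁆∣≡n∸1 u })
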